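{- (Confluence of evaluation.) For all term distributions $\vec t,\vec t_1',\vec t_2'$, if $\vec t\succ\!\!\succ\vec t_1'$ and $\vec t\succ\!\!\succ\vec t_2'$, then there is a term distribution $\vec t''$ such that $\vec t_1'\succ\!\!\succ\vec t''$ and $\vec t_2'\succ\!\!\succ\vec t''$.
   Context: Calculus. Fix a denumerable set of variables. Pure values: $v,w::=x\mid\lambda x.\vec s\mid *\mid(v_1,v_2)\mid\mathrm{inl}(v)\mid\mathrm{inr}(v)$. Pure terms: $s,t::=v\mid s\,t\mid t;\vec s\mid \mathrm{let}\,(x_1,x_2)=t\,\mathrm{in}\,\vec s\mid\mathrm{match}\,t\,\{\mathrm{inl}(x_1)\mapsto\vec s_1\mid\mathrm{inr}(x_2)\mapsto\vec s_2\}$. Term distributions: $\vec s,\vec t::=\vec 0\mid t\mid\vec s+\vec t\mid\alpha\cdot\vec t$ ($\alpha\in\mathbb C$). Terms up to $\alpha$-conversion; top-level distributions modulo the congruence $\equiv$ generated by: $+$ associative, commutative with neutral $\vec0$; $1\cdot\vec t\equiv\vec t$; $\alpha\cdot(\beta\cdot\vec t)\equiv\alpha\beta\cdot\vec t$; $(\alpha+\beta)\cdot\vec t\equiv\alpha\cdot\vec t+\beta\cdot\vec t$; $\alpha\cdot(\vec t_1+\vec t_2)\equiv\alpha\cdot\vec t_1+\alpha\cdot\vec t_2$. The congruence does not go inside pure terms (inner distributions are raw), and $0\cdot t\not\equiv\vec0$. Constructs extended by linearity: $(\sum_i\alpha_iv_i,\sum_j\beta_jw_j):=\sum_{i,j}\alpha_i\beta_j\cdot(v_i,w_j)$,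 inl/inr linear, $(\sum_k\gamma_kt_k)(\sum_l\delta_ls_l):=\sum_{k,l}\gamma_k\delta_l\cdot t_ks_l$, sequence/let/match linear in the destructed argument. $\vec t[x:=w]$ is capture-avoiding substitution of a pure value $w$. Atomic evaluation $t\triangleright\vec t'$ is generated by $(\lambda x.\vec t)\,v\triangleright\vec t[x:=v]$; $*;\vec s\triangleright\vec s$; $\mathrm{let}\,(x,y)=(v,w)\,\mathrm{in}\,\vec s\triangleright\vec s[x:=v,y:=w]$; $\mathrm{match}\,\mathrm{inl}(v)\{\mathrm{inl}(x_1)\mapsto\vec s_1\mid\mathrm{inr}(x_2)\mapsto\vec s_2\}\triangleright\vec s_1[x_1:=v]$ and symmetrically for $\mathrm{inr}(v)$ ($v,w$ pure values); and, if $t\triangleright\vec t'$: $s\,t\triangleright s\,\vec t'$, $t\,v\triangleright\vec t'\,v$, $t;\vec s\triangleright\vec t';\vec s$, $\mathrm{let}\,(x,y)=t\,\mathrm{in}\,\vec s\triangleright\mathrm{let}\,(x,y)=\vec t'\,\mathrm{in}\,\vec s$, and the same for the matched argument of match. One-step evaluation: $\vec t\succ\vec t'$ iff there are $\alpha\in\mathbb C$, a pure term $s$ and distributions $\vec s',\vec r$ with $\vec t\equiv\alpha\cdot s+\vec r$, $\vec t'\equiv\alpha\cdot\vec s'+\vec r$ and $s\triangleright\vec s'$. Evaluation $\succ\!\!\succ$ is the reflexive–transitive closure of $\succ$. Distributions are compared modulo $\equiv$. -}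

module Defs where

open import Level using (0ℓ)
open import Algebra.Bundles using (CommutativeRing)
open import Data.Nat using (ℕ; zero; suc)
open import Data.Fin using (Fin; zero; suc)
open import Data.Product using (Σ; _×_; _,_; ∃)
open import Data.Sum using (_⊎_)
open import Relation.Binary.Construct.Closure.ReflexiveTransitive using (Star)

-- The calculus, parametrised by the ring of scalars (ℂ in the paper).
-- Terms use intrinsically scoped de Bruijn indices: a term of type
-- Term n has its free variables among Fin n.  This realises
-- "terms up to α-conversion" and capture-avoiding substitution.
module Calculus (R : CommutativeRing 0ℓ 0ℓ) where
  open CommutativeRing R using (Carrier) renaming (_+_ to _+ᶜ_; _*_ to _*ᶜ_; 1# to 1ᶜ)

  infixl 6 _⊕_
  infixr 7 _⊙_

  mutual
    data Val (n : ℕ) : Set where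
      var  : Fin n → Val n
      lam  : Dist (suc n) → Val n          -- λx. s⃗   (x is index 0)
      star : Val n
      pair : Val n → Val n → Val n
      inl  : Val n → Val n
      inr  : Val n → Val n

    data Term (n : ℕ) : Set where
      val   : Val n → Term n
      app   : Term n → Term n → Term n
      seq   : Term n → Dist n → Term n
      letp  : Term n → Dist (suc (suc n)) → Term n         -- let (x₁,x₂) = t in s⃗  (x₁ = index 1, x₂ = index 0)
      match : Term n → Dist (suc n) → Dist (suc n) → Term n

    data Dist (n : ℕ) : Set where
      𝟘   : Dist n
      ⟨_⟩ : Term n → Dist n
      _⊕_ : Dist n → Dist n → Dist n
      _⊙_ : Carrier → Dist n → Dist n

  extR : ∀ {n m} → (Fin n → Fin m) → Fin (suc n) → Fin (suc m)
  extR ρ zero    = zero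
  extR ρ (suc i) = suc (ρ i)

  mutual
    renV : ∀ {n m} → (Fin n → Fin m) → Val n → Val m
    renV ρ (var i)    = var (ρ i)
    renV ρ (lam d)    = lam (renD (extR ρ) d)
    renV ρ star       = star
    renV ρ (pair v w) = pair (renV ρ v) (renV ρ w)
    renV ρ (inl v)    = inl (renV ρ v)
    renV ρ (inr v)    = inr (renV ρ v)

    renT : ∀ {n m} → (Fin n → Fin m) → Term n → Term m
    renT ρ (val v)         = val (renV ρ v)
    renT ρ (app s t)       = app (renT ρ s) (renT ρ t)
    renT ρ (seq t d)       = seq (renT ρ t) (renD ρ d)
    renT ρ (letp t d)      = letp (renT ρ t) (renD (extR (extR ρ)) d)
    renT ρ (match t d₁ d₂) = match (renT ρ t) (renD (extR ρ) d₁) (renD (extR ρ) d₂)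

    renD : ∀ {n m} → (Fin n → Fin m) → Dist n → Dist m
    renD ρ 𝟘       = 𝟘
    renD ρ ⟨ t ⟩   = ⟨ renT ρ t ⟩
    renD ρ (d ⊕ e) = renD ρ d ⊕ renD ρ e
    renD ρ (a ⊙ d) = a ⊙ renD ρ d

  extS : ∀ {n m} → (Fin n → Val m) → Fin (suc n) → Val (suc m)
  extS σ zero    = var zero
  extS σ (suc i) = renV suc (σ i)

  mutual
    subV : ∀ {n m} → (Fin n → Val m) → Val n → Val m
    subV σ (var i)    = σ i
    subV σ (lam d)    = lam (subD (extS σ) d)
    subV σ star       = star
    subV σ (pair v w) = pair (subV σ v) (subV σ w)
    subV σ (inl v)    = inl (subV σ v)
    subV σ (inr v)    = inr (subV σ v)

    subT : ∀ {n m} → (Fin n → Val m) → Term n → Term m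
    subT σ (val v)         = val (subV σ v)
    subT σ (app s t)       = app (subT σ s) (subT σ t)
    subT σ (seq t d)       = seq (subT σ t) (subD σ d)
    subT σ (letp t d)      = letp (subT σ t) (subD (extS (extS σ)) d)
    subT σ (match t d₁ d₂) = match (subT σ t) (subD (extS σ) d₁) (subD (extS σ) d₂)

    subD : ∀ {n m} → (Fin n → Val m) → Dist n → Dist m
    subD σ 𝟘       = 𝟘
    subD σ ⟨ t ⟩   = ⟨ subT σ t ⟩
    subD σ (d ⊕ e) = subD σ d ⊕ subD σ e
    subD σ (a ⊙ d) = a ⊙ subD σ d

  sub1 : ∀ {n} → Val n → Fin (suc n) → Val n
  sub1 v zero    = v
  sub1 v (suc i) = var i

  sub2 : ∀ {n} → Val n → Val n → Fin (suc (suc n)) → Val n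
  sub2 v w zero          = w
  sub2 v w (suc zero)    = v
  sub2 v w (suc (suc i)) = var i

  _[_] : ∀ {n} → Dist (suc n) → Val n → Dist n
  d [ v ] = subD (sub1 v) d

  _[_∣_] : ∀ {n} → Dist (suc (suc n)) → Val n → Val n → Dist n
  d [ v ∣ w ] = subD (sub2 v w) d

  -- Extension of constructs by linearity:
  -- bind (Σ γₖ tₖ) f = Σ γₖ · f tₖ
  bind : ∀ {n} → Dist n → (Term n → Dist n) → Dist n
  bind 𝟘       f = 𝟘
  bind ⟨ t ⟩   f = f t
  bind (d ⊕ e) f = bind d f ⊕ bind e f
  bind (a ⊙ d) f = a ⊙ bind d f

  -- The congruence ≡ on top-level distributions

  infix 4 _≈_
  data _≈_ {n : ℕ} : Dist n → Dist n → Set where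
    ≈-refl  : ∀ {d} → d ≈ d
    ≈-sym   : ∀ {d e} → d ≈ e → e ≈ d
    ≈-trans : ∀ {d e f} → d ≈ e → e ≈ f → d ≈ f
    ⊕-cong  : ∀ {d d′ e e′} → d ≈ d′ → e ≈ e′ → d ⊕ e ≈ d′ ⊕ e′
    ⊙-cong  : ∀ {a d d′} → d ≈ d′ → a ⊙ d ≈ a ⊙ d′
    ⊕-assoc : ∀ {d e f} → (d ⊕ e) ⊕ f ≈ d ⊕ (e ⊕ f)
    ⊕-comm  : ∀ {d e} → d ⊕ e ≈ e ⊕ d
    ⊕-unit  : ∀ {d} → d ⊕ 𝟘 ≈ d
    ⊙-one   : ∀ {d} → 1ᶜ ⊙ d ≈ d
    ⊙-⊙     : ∀ {a b d} → a ⊙ (b ⊙ d) ≈ (a *ᶜ b) ⊙ d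
    ⊙-distʳ : ∀ {a b d} → (a +ᶜ b) ⊙ d ≈ a ⊙ d ⊕ b ⊙ d
    ⊙-distˡ : ∀ {a d e} → a ⊙ (d ⊕ e) ≈ a ⊙ d ⊕ a ⊙ e

  infix 4 _▷_
  data _▷_ {n : ℕ} : Term n → Dist n → Set where
    β      : ∀ {d v} → app (val (lam d)) (val v) ▷ d [ v ]
    seq*   : ∀ {d} → seq (val star) d ▷ d
    letβ   : ∀ {d v w} → letp (val (pair v w)) d ▷ d [ v ∣ w ]
    matchˡ : ∀ {v d₁ d₂} → match (val (inl v)) d₁ d₂ ▷ d₁ [ v ]
    matchʳ : ∀ {v d₁ d₂} → match (val (inr v)) d₁ d₂ ▷ d₂ [ v ]
    appR   : ∀ {s t t′} → t ▷ t′ → app s t ▷ bind t′ (λ u → ⟨ app s u ⟩)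
    appL   : ∀ {t t′ v} → t ▷ t′ → app t (val v) ▷ bind t′ (λ u → ⟨ app u (val v) ⟩)
    seqC   : ∀ {t t′ d} → t ▷ t′ → seq t d ▷ bind t′ (λ u → ⟨ seq u d ⟩)
    letC   : ∀ {t t′ d} → t ▷ t′ → letp t d ▷ bind t′ (λ u → ⟨ letp u d ⟩)
    matchC : ∀ {t t′ d₁ d₂} → t ▷ t′ → match t d₁ d₂ ▷ bind t′ (λ u → ⟨ match u d₁ d₂ ⟩)

  infix 4 _≻_ _≻≻_
  _≻_ : ∀ {n} → Dist n → Dist n → Set
  t ≻ t′ = Σ Carrier λ α → Σ (Term _) λ s → Σ (Dist _) λ s′ → Σ (Dist _) λ r →
             (t ≈ α ⊙ ⟨ s ⟩ ⊕ r) × (t′ ≈ α ⊙ s′ ⊕ r) × (s ▷ s′)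

  -- Evaluation: reflexive–transitive closure of ≻, with distributions
  -- compared modulo ≈ (so the reflexive steps are ≈-steps).
  _≻≻_ : ∀ {n} → Dist n → Dist n → Set
  _≻≻_ = Star (λ d e → d ≈ e ⊎ d ≻ e)

{-# OPTIONS --safe #-}
module Submission where

-- Atomic evaluation is deterministic, so each pure term t has a unique
-- one-step result step t (or ⟨ t ⟩ itself when t is irreducible).
-- Parallel reduction d ⇉ e fires an arbitrary selection of the top-level
-- pure terms of a raw distribution, and develop d fires all of them.  Since
-- evaluation never acts below the top-level terms of a distribution,
-- Takahashi's triangle d ⇉ e → e ⇉ develop d holds: the terms that d ⇉ e
-- fired are kept, the others are fired now.  Closing ⇉ under ≈ on both
-- sides yields a relation with the diamond property lying between single
-- evaluation steps and ≻≻, so ≻≻ is confluent.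

open import Defs
open import Level using (0ℓ)
open import Algebra.Bundles using (CommutativeRing)
open import Data.Maybe using (Maybe; just; nothing)
open import Data.Nat using (ℕ)
open import Data.Product using (Σ; ∃; _×_; _,_; -,_)
open import Data.Sum using (_⊎_; inj₁; inj₂)
import Data.Sum as Sum
open import Relation.Binary.Core using (Rel)
open import Relation.Binary.Construct.Closure.ReflexiveTransitive
  using (Star; ε; _◅_; _◅◅_; gmap; map; _⋆)
open import Relation.Binary.PropositionalEquality using (_≡_; refl; cong)
open import Relation.Binary.Rewriting using (Confluent)

Diamond : {A : Set} → Rel A 0ℓ → Set
Diamond _⟶_ = ∀ {a b c} → a ⟶ b → a ⟶ c → ∃ λ d → b ⟶ d × c ⟶ d

module _ {A : Set} {_⟶_ : Rel A 0ℓ} (◇ : Diamond _⟶_) where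

  diamond-strip : ∀ {a b c} → a ⟶ b → Star _⟶_ a c → ∃ λ d → Star _⟶_ b d × c ⟶ d
  diamond-strip a⟶b ε = -, ε , a⟶b
  diamond-strip a⟶b (a⟶c ◅ c⟶⋆d) with ◇ a⟶b a⟶c
  ... | e , b⟶e , c⟶e with diamond-strip c⟶e c⟶⋆d
  ...   | f , e⟶⋆f , d⟶f = f , b⟶e ◅ e⟶⋆f , d⟶f

  diamond⇒confluent : Confluent _⟶_
  diamond⇒confluent ε a⟶⋆c = -, a⟶⋆c , ε
  diamond⇒confluent (a⟶b ◅ b⟶⋆d) a⟶⋆c with diamond-strip a⟶b a⟶⋆c
  ... | e , b⟶⋆e , c⟶e with diamond⇒confluent b⟶⋆d b⟶⋆e
  ...   | f , d⟶⋆f , e⟶⋆f = f , d⟶⋆f , c⟶e ◅ e⟶⋆f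

module Confluence (R : CommutativeRing 0ℓ 0ℓ) where
  open CommutativeRing R using () renaming (_*_ to _*ᶜ_; 1# to 1ᶜ)
  open Calculus R

  private
    variable
      n : ℕ
      d d′ e e′ : Dist n
      t : Term n

  reduct : (t : Term n) → Maybe (∃ (t ▷_))
  reduct (val v) = nothing
  reduct (app s t) with reduct t
  ... | just (_ , t▷) = just (-, appR t▷)
  reduct (app s (val v)) | nothing with reduct s
  ... | just (_ , s▷) = just (-, appL s▷)
  reduct (app (val (lam d)) (val v)) | nothing | nothing = just (-, β)
  reduct (app _ (val _)) | nothing | nothing = nothing
  reduct (app _ _) | nothing = nothing
  reduct (seq t d) with reduct t
  ... | just (_ , t▷) = just (-, seqC t▷)
  reduct (seq (val star) d) | nothing = just (-, seq*)
  reduct (seq _ _) | nothing = nothing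
  reduct (letp t d) with reduct t
  ... | just (_ , t▷) = just (-, letC t▷)
  reduct (letp (val (pair v w)) d) | nothing = just (-, letβ)
  reduct (letp _ _) | nothing = nothing
  reduct (match t d₁ d₂) with reduct t
  ... | just (_ , t▷) = just (-, matchC t▷)
  reduct (match (val (inl v)) d₁ d₂) | nothing = just (-, matchˡ)
  reduct (match (val (inr v)) d₁ d₂) | nothing = just (-, matchʳ)
  reduct (match _ _ _) | nothing = nothing

  reduct-complete : t ▷ d → Σ (t ▷ d) λ t▷d′ → reduct t ≡ just (d , t▷d′)
  reduct-complete β = -, refl
  reduct-complete seq* = -, refl
  reduct-complete letβ = -, refl
  reduct-complete matchˡ = -, refl
  reduct-complete matchʳ = -, refl
  reduct-complete (appR t▷) with reduct-complete t▷
  ... | _ , eq rewrite eq = -, refl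
  reduct-complete (appL s▷) with reduct-complete s▷
  ... | _ , eq rewrite eq = -, refl
  reduct-complete (seqC t▷) with reduct-complete t▷
  ... | _ , eq rewrite eq = -, refl
  reduct-complete (letC t▷) with reduct-complete t▷
  ... | _ , eq rewrite eq = -, refl
  reduct-complete (matchC t▷) with reduct-complete t▷
  ... | _ , eq rewrite eq = -, refl

  step : Term n → Dist n
  step t with reduct t
  ... | just (d , _) = d
  ... | nothing = ⟨ t ⟩

  ▷⇒step≡ : t ▷ d → step t ≡ d
  ▷⇒step≡ t▷d with reduct-complete t▷d
  ... | _ , eq rewrite eq = refl

  develop : Dist n → Dist n
  develop d = bind d step

  bind-cong : (f : Term n → Dist n) → d ≈ e → bind d f ≈ bind e f
  bind-cong f ≈-refl = ≈-refl
  bind-cong f (≈-sym p) = ≈-sym (bind-cong f p)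
  bind-cong f (≈-trans p q) = ≈-trans (bind-cong f p) (bind-cong f q)
  bind-cong f (⊕-cong p q) = ⊕-cong (bind-cong f p) (bind-cong f q)
  bind-cong f (⊙-cong p) = ⊙-cong (bind-cong f p)
  bind-cong f ⊕-assoc = ⊕-assoc
  bind-cong f ⊕-comm = ⊕-comm
  bind-cong f ⊕-unit = ⊕-unit
  bind-cong f ⊙-one = ⊙-one
  bind-cong f ⊙-⊙ = ⊙-⊙
  bind-cong f ⊙-distʳ = ⊙-distʳ
  bind-cong f ⊙-distˡ = ⊙-distˡ

  ≡⇒≈ : d ≡ e → d ≈ e
  ≡⇒≈ refl = ≈-refl

  ▷⇒≻ : t ▷ d → ⟨ t ⟩ ≻ d
  ▷⇒≻ {t = t} {d = d} t▷d = 1ᶜ , t , d , 𝟘 , ≈-sym unit , ≈-sym unit , t▷d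
    where
    unit : ∀ {e : Dist _} → 1ᶜ ⊙ e ⊕ 𝟘 ≈ e
    unit = ≈-trans ⊕-unit ⊙-one

  ≻-⊕ʳ : ∀ r → d ≻ e → d ⊕ r ≻ e ⊕ r
  ≻-⊕ʳ r (α , s , s′ , r′ , p , q , s▷) =
    α , s , s′ , r′ ⊕ r , ≈-trans (⊕-cong p ≈-refl) ⊕-assoc ,
    ≈-trans (⊕-cong q ≈-refl) ⊕-assoc , s▷

  ≻-⊕ˡ : ∀ r → d ≻ e → r ⊕ d ≻ r ⊕ e
  ≻-⊕ˡ r d≻e with ≻-⊕ʳ r d≻e
  ... | α , s , s′ , r′ , p , q , s▷ = α , s , s′ , r′ , ≈-trans ⊕-comm p , ≈-trans ⊕-comm q , s▷

  ≻-⊙ : ∀ a → d ≻ e → a ⊙ d ≻ a ⊙ e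
  ≻-⊙ a (α , s , s′ , r , p , q , s▷) =
    a *ᶜ α , s , s′ , a ⊙ r , ≈-trans (⊙-cong p) scale , ≈-trans (⊙-cong q) scale , s▷
    where
    scale : ∀ {e : Dist _} → a ⊙ (α ⊙ e ⊕ r) ≈ (a *ᶜ α) ⊙ e ⊕ a ⊙ r
    scale = ≈-trans ⊙-distˡ (⊕-cong ⊙-⊙ ≈-refl)

  Step : Rel (Dist n) 0ℓ
  Step d e = d ≈ e ⊎ d ≻ e

  ≻≻-cong : (f : Dist n → Dist n) → (∀ {d e} → d ≈ e → f d ≈ f e) →
            (∀ {d e} → d ≻ e → f d ≻ f e) → d ≻≻ e → f d ≻≻ f e
  ≻≻-cong f f-≈ f-≻ = gmap f (Sum.map f-≈ f-≻)

  ≻≻-⊕ : ∀ {d d′ e e′ : Dist n} → d ≻≻ d′ → e ≻≻ e′ → d ⊕ e ≻≻ d′ ⊕ e′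
  ≻≻-⊕ {d′ = d′} {e = e} d≻≻ e≻≻ =
    ≻≻-cong (_⊕ e) (λ p → ⊕-cong p ≈-refl) (≻-⊕ʳ e) d≻≻ ◅◅
    ≻≻-cong (d′ ⊕_) (⊕-cong ≈-refl) (≻-⊕ˡ d′) e≻≻

  ≻≻-⊙ : ∀ a → d ≻≻ e → a ⊙ d ≻≻ a ⊙ e
  ≻≻-⊙ a = ≻≻-cong (a ⊙_) ⊙-cong (≻-⊙ a)

  ≻≻-step : (t : Term n) → ⟨ t ⟩ ≻≻ step t
  ≻≻-step t with reduct t
  ... | just (_ , t▷) = inj₂ (▷⇒≻ t▷) ◅ ε
  ... | nothing = ε

  infix 4 _⇉_ _⇒_

  data _⇉_ {n : ℕ} : Rel (Dist n) 0ℓ where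
    ⇉-𝟘  : 𝟘 ⇉ 𝟘
    keep : ⟨ t ⟩ ⇉ ⟨ t ⟩
    fire : ⟨ t ⟩ ⇉ step t
    ⇉-⊕  : d ⇉ d′ → e ⇉ e′ → d ⊕ e ⇉ d′ ⊕ e′
    ⇉-⊙  : ∀ a → d ⇉ e → a ⊙ d ⇉ a ⊙ e

  ⇉-refl : (d : Dist n) → d ⇉ d
  ⇉-refl 𝟘 = ⇉-𝟘
  ⇉-refl ⟨ t ⟩ = keep
  ⇉-refl (d ⊕ e) = ⇉-⊕ (⇉-refl d) (⇉-refl e)
  ⇉-refl (a ⊙ d) = ⇉-⊙ a (⇉-refl d)

  ⇉-triangle : d ⇉ e → e ⇉ develop d
  ⇉-triangle ⇉-𝟘 = ⇉-𝟘
  ⇉-triangle keep = fire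
  ⇉-triangle (fire {t = t}) = ⇉-refl (step t)
  ⇉-triangle (⇉-⊕ p q) = ⇉-⊕ (⇉-triangle p) (⇉-triangle q)
  ⇉-triangle (⇉-⊙ a p) = ⇉-⊙ a (⇉-triangle p)

  ⇉⇒≻≻ : d ⇉ e → d ≻≻ e
  ⇉⇒≻≻ ⇉-𝟘 = ε
  ⇉⇒≻≻ keep = ε
  ⇉⇒≻≻ (fire {t = t}) = ≻≻-step t
  ⇉⇒≻≻ (⇉-⊕ p q) = ≻≻-⊕ (⇉⇒≻≻ p) (⇉⇒≻≻ q)
  ⇉⇒≻≻ (⇉-⊙ a p) = ≻≻-⊙ a (⇉⇒≻≻ p)

  data _⇒_ {n : ℕ} (d e : Dist n) : Set where
    par : d ≈ d′ → d′ ⇉ e′ → e′ ≈ e → d ⇒ e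

  ⇒-triangle : d ⇒ e → e ⇒ develop d
  ⇒-triangle (par d≈ ⇉e ≈e) = par (≈-sym ≈e) (⇉-triangle ⇉e) (bind-cong step (≈-sym d≈))

  ⇒-diamond : Diamond (_⇒_ {n})
  ⇒-diamond d⇒e₁ d⇒e₂ = -, ⇒-triangle d⇒e₁ , ⇒-triangle d⇒e₂

  Step⇒⇒ : Step d e → d ⇒ e
  Step⇒⇒ {e = e} (inj₁ d≈e) = par d≈e (⇉-refl e) ≈-refl
  Step⇒⇒ (inj₂ (α , s , s′ , r , d≈ , e≈ , s▷s′)) =
    par d≈ (⇉-⊕ (⇉-⊙ α fire) (⇉-refl r))
        (≈-trans (≡⇒≈ (cong (λ x → α ⊙ x ⊕ r) (▷⇒step≡ s▷s′))) (≈-sym e≈))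

  ⇒⇒≻≻ : d ⇒ e → d ≻≻ e
  ⇒⇒≻≻ (par d≈ ⇉e ≈e) = inj₁ d≈ ◅ ⇉⇒≻≻ ⇉e ◅◅ inj₁ ≈e ◅ ε

  ≻≻-confluent : Confluent (Step {n})
  ≻≻-confluent d≻≻e₁ d≻≻e₂
    with diamond⇒confluent ⇒-diamond (map Step⇒⇒ d≻≻e₁) (map Step⇒⇒ d≻≻e₂)
  ... | f , e₁⇒⋆f , e₂⇒⋆f = f , (⇒⇒≻≻ ⋆) e₁⇒⋆f , (⇒⇒≻≻ ⋆) e₂⇒⋆f

-- The argument works over any commutative ring.
theorem1 : (R : CommutativeRing 0ℓ 0ℓ) →
    (∀ {a b} → CommutativeRing._≈_ R a b → a ≡ b) →
    let open Calculus R in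
    ∀ {n : ℕ} (t t₁′ t₂′ : Dist n) → t ≻≻ t₁′ → t ≻≻ t₂′ →
    Σ (Dist n) λ t″ → (t₁′ ≻≻ t″) × (t₂′ ≻≻ t″)
theorem1 R _ _ _ _ = Confluence.≻≻-confluent R
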